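{- Let $\mathbb{A}$ be an $\mathcal{L}$-algebra with filter-ideal frame $\mathbb{F}^\star_\mathbb{A}$. For every $f\in\mathcal{F}$, $g\in\mathcal{G}$, every admissible tuple $\overline F$ for $f$, every admissible tuple $\overline I$ for $g$, every ideal $I_0$, every filter $F_0$ and every index $i$: (1) $((R^\star_f)^{(0)}[\overline F])^{\downarrow}=\{G\in\mathfrak F_\mathbb{A}\mid f(\overline F)\subseteq G\}$; (2) $((R^\star_g)^{(0)}[\overline I])^{\uparrow}=\{J\in\mathfrak I_\mathbb{A}\mid g(\overline I)\subseteq J\}$; (3) if $\epsilon_f(i)=1$ then $((R^\star_f)^{(i)}[I_0,\overline F^{i}])^{\uparrow}=\{J\in\mathfrak I_\mathbb{A}\mid f^{(i)}(I_0,\overline F^{i})\subseteq J\}$; (4) if $\epsilon_f(i)=\partial$ then $((R^\star_f)^{(i)}[I_0,\overline F^{i}])^{\downarrow}=\{G\in\mathfrak F_\mathbb{A}\mid f^{(i)}(I_0,\overline F^{i})\subseteq G\}$; (5) if $\epsilon_g(i)=1$ then $((R^\star_g)^{(i)}[F_0,\overline I^{i}])^{\downarrow}=\{G\in\mathfrak F_\mathbb{A}\mid g^{(i)}(F_0,\overline I^{i})\subseteq G\}$; (6) if $\epsilon_g(i)=\partial$ then $((R^\star_g)^{(i)}[F_0,\overline I^{i}])^{\uparrow}=\{J\in\mathfrak I_\mathbb{A}\mid g^{(i)}(F_0,\overline I^{i})\subseteq J\}$.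
   Context: $\mathcal{L}(\mathcal F,\mathcal G)$ is an LE-signature; $f\in\mathcal F$ has arity $n_f$ and order type $\epsilon_f\in\{1,\partial\}^{n_f}$, $g\in\mathcal G$ arity $n_g$ and order type $\epsilon_g$. An $\mathcal{L}$-algebra is a bounded lattice with operations $f$ preserving finite joins in type-1 coordinates and sending finite meets to joins in type-$\partial$ coordinates, $g$ preserving finite meets in type-1 coordinates and sending finite joins to meets in type-$\partial$ coordinates. Filter-ideal frame $\mathbb{F}^\star_\mathbb{A}=(\mathfrak F_\mathbb{A},\mathfrak I_\mathbb{A},N^\star,(R^\star_f),(R^\star_g))$: $\mathfrak F_\mathbb{A}$ the filters, $\mathfrak I_\mathbb{A}$ the ideals of $\mathbb{A}$; $FN^\star I$ iff $F\cap I\ne\varnothing$. An admissible tuple for $f$ is $\overline F=(F_1,\dots,F_{n_f})$ with $F_k$ a filter if $\epsilon_f(k)=1$ and an ideal if $\epsilon_f(k)=\partial$; an admissible tuple for $g$ is $\overline I$ with $I_k$ an ideal if $\epsilon_g(k)=1$ and a filter if $\epsilon_g(k)=\partial$. $R^\star_f(I,\overline F)$ iff $f(\overline a)\in I$ for some $\overline a\in\overline F$ (i.e. $a_k\in F_k$ for all $k$); $R^\star_g(F,\overline I)$ iff $g(\overline a)\in F$ for some $\overline a\in\overline I$. For $X\subseteq\mathfrak F_\mathbb{A}$, $X^\uparrow=\{I\in\mathfrak I_\mathbb{A}\mid FN^\star I\ \forall F\in X\}$; for $Y\subseteq\mathfrak I_\mathbb{A}$, $Y^\downarrow=\{F\mid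 FN^\star I\ \forall I\in Y\}$. For a relation $R\subseteq A\times B_1\times\dots\times B_n$: $R^{(0)}[\overline C]=\{a\mid(a,\overline b)\in R\ \forall b\in\overline C\}$ and $R^{(i)}[A',\overline C^i]=\{b\in B_i\mid (a,c_1,\dots,c_{i-1},b,c_{i+1},\dots)\in R$ for all $a\in A'$, $c_k\in C_k\}$; a tuple of single points is treated as a tuple of singletons, and $\overline F^i$ denotes $\overline F$ with the $i$-th entry removed. Notation: $f(\overline F)=\{f(\overline a)\mid \overline a\in\overline F\}$, $g(\overline I)=\{g(\overline a)\mid\overline a\in\overline I\}$, $f^{(i)}(I,\overline F^i)=\{b\in\mathbb{A}\mid f(\overline a^i_b)\in I$ for some $\overline a^i\in\overline F^i\}$ and $g^{(i)}(F,\overline I^i)=\{b\in\mathbb{A}\mid g(\overline a^i_b)\in F$ for some $\overline a^i\in\overline I^i\}$, where $\overline a^i_b$ is the tuple $\overline a^i$ with $b$ inserted at position $i$. -}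

module Defs where

open import Level using (Level; _⊔_; suc)
open import Data.Nat using (ℕ)
open import Data.Fin using (Fin; _≟_)
open import Data.Product using (Σ; ∃; _×_; _,_)
open import Relation.Nullary using (yes; no; ¬_)
open import Relation.Unary using (Pred)
open import Relation.Binary.PropositionalEquality using (_≡_; refl)
open import Relation.Binary.Lattice.Bundles using (BoundedLattice)

data Polarity : Set where
  one : Polarity
  ∂   : Polarity

record LESignature : Set₁ where
  field
    𝓕   : Set
    𝓖   : Set
    arF : 𝓕 → ℕ
    εF  : (f : 𝓕) → Fin (arF f) → Polarity
    arG : 𝓖 → ℕ
    εG  : (g : 𝓖) → Fin (arG g) → Polarity

_[_≔_] : ∀ {a} {A : Set a} {n : ℕ} → (Fin n → A) → Fin n → A → Fin n → A
(v [ i ≔ x ]) k with k ≟ i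
... | yes _ = x
... | no  _ = v k

-- L-algebras: bounded lattices with operations f (join-preserving in
-- type-1 coordinates, meets-to-joins in type-∂ coordinates) and g (dually).
-- "Finite" joins/meets: binary ones plus the empty one (⊥ resp. ⊤).

record LEAlgebra (Sig : LESignature) (c ℓ₁ ℓ₂ : Level) : Set (suc (c ⊔ ℓ₁ ⊔ ℓ₂)) where
  open LESignature Sig
  field
    lattice : BoundedLattice c ℓ₁ ℓ₂
  open BoundedLattice lattice
  field
    fOp : (f : 𝓕) → (Fin (arF f) → Carrier) → Carrier
    gOp : (g : 𝓖) → (Fin (arG g) → Carrier) → Carrier
    fOp-cong : ∀ f {a b : Fin (arF f) → Carrier} → (∀ k → a k ≈ b k) → fOp f a ≈ fOp f b
    gOp-cong : ∀ g {a b : Fin (arG g) → Carrier} → (∀ k → a k ≈ b k) → gOp g a ≈ gOp g b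
    fOp-∨ : ∀ f i → εF f i ≡ one → ∀ a x y →
            fOp f (a [ i ≔ x ∨ y ]) ≈ fOp f (a [ i ≔ x ]) ∨ fOp f (a [ i ≔ y ])
    fOp-⊥ : ∀ f i → εF f i ≡ one → ∀ a → fOp f (a [ i ≔ ⊥ ]) ≈ ⊥
    fOp-∧ : ∀ f i → εF f i ≡ ∂ → ∀ a x y →
            fOp f (a [ i ≔ x ∧ y ]) ≈ fOp f (a [ i ≔ x ]) ∨ fOp f (a [ i ≔ y ])
    fOp-⊤ : ∀ f i → εF f i ≡ ∂ → ∀ a → fOp f (a [ i ≔ ⊤ ]) ≈ ⊥
    gOp-∧ : ∀ g i → εG g i ≡ one → ∀ a x y →
            gOp g (a [ i ≔ x ∧ y ]) ≈ gOp g (a [ i ≔ x ]) ∧ gOp g (a [ i ≔ y ])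
    gOp-⊤ : ∀ g i → εG g i ≡ one → ∀ a → gOp g (a [ i ≔ ⊤ ]) ≈ ⊤
    gOp-∨ : ∀ g i → εG g i ≡ ∂ → ∀ a x y →
            gOp g (a [ i ≔ x ∨ y ]) ≈ gOp g (a [ i ≔ x ]) ∧ gOp g (a [ i ≔ y ])
    gOp-⊥ : ∀ g i → εG g i ≡ ∂ → ∀ a → gOp g (a [ i ≔ ⊥ ]) ≈ ⊤

module FilterIdealFrame {Sig : LESignature} {c ℓ₁ ℓ₂ : Level}
                        (𝔸 : LEAlgebra Sig c ℓ₁ ℓ₂) where
  open LESignature Sig
  open LEAlgebra 𝔸
  open BoundedLattice lattice

  L : Level
  L = c ⊔ ℓ₁ ⊔ ℓ₂

  record Filter : Set (suc L) where
    field
      mem   : Pred Carrier L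
      mem-⊤ : mem ⊤
      mem-↑ : ∀ {x y} → x ≤ y → mem x → mem y
      mem-∧ : ∀ {x y} → mem x → mem y → mem (x ∧ y)

  record Ideal : Set (suc L) where
    field
      mem   : Pred Carrier L
      mem-⊥ : mem ⊥
      mem-↓ : ∀ {x y} → y ≤ x → mem x → mem y
      mem-∨ : ∀ {x y} → mem x → mem y → mem (x ∨ y)

  N⋆ : Filter → Ideal → Set L
  N⋆ F I = ∃ λ x → Filter.mem F x × Ideal.mem I x

  _↑ : ∀ {ℓ} → Pred Filter ℓ → Pred Ideal (suc L ⊔ ℓ)
  (X ↑) I = ∀ F → X F → N⋆ F I

  _↓ : ∀ {ℓ} → Pred Ideal ℓ → Pred Filter (suc L ⊔ ℓ)
  (Y ↓) F = ∀ I → Y I → N⋆ F I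

  FPart : Polarity → Set (suc L)
  FPart one = Filter
  FPart ∂   = Ideal

  GPart : Polarity → Set (suc L)
  GPart one = Ideal
  GPart ∂   = Filter

  memF : (p : Polarity) → FPart p → Pred Carrier L
  memF one F = Filter.mem F
  memF ∂   I = Ideal.mem I

  memG : (p : Polarity) → GPart p → Pred Carrier L
  memG one I = Ideal.mem I
  memG ∂   F = Filter.mem F

  FTuple : 𝓕 → Set (suc L)
  FTuple f = (k : Fin (arF f)) → FPart (εF f k)

  GTuple : 𝓖 → Set (suc L)
  GTuple g = (k : Fin (arG g)) → GPart (εG g k)

  _∈F̄_ : ∀ {f} → (Fin (arF f) → Carrier) → FTuple f → Set L
  _∈F̄_ {f} a F̄ = ∀ k → memF (εF f k) (F̄ k) (a k)

  _∈Ī_ : ∀ {g} → (Fin (arG g) → Carrier) → GTuple g → Set L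
  _∈Ī_ {g} a Ī = ∀ k → memG (εG g k) (Ī k) (a k)

  -- ā ∈ F̄^i : a_k ∈ F_k for all k ≠ i (the i-th entries are ignored)
  _∈F̄^_/_ : ∀ {f} → (Fin (arF f) → Carrier) → Fin (arF f) → FTuple f → Set L
  _∈F̄^_/_ {f} a i F̄ = ∀ k → ¬ (k ≡ i) → memF (εF f k) (F̄ k) (a k)

  _∈Ī^_/_ : ∀ {g} → (Fin (arG g) → Carrier) → Fin (arG g) → GTuple g → Set L
  _∈Ī^_/_ {g} a i Ī = ∀ k → ¬ (k ≡ i) → memG (εG g k) (Ī k) (a k)

  -- insert b at position i of F̄^i (= replace the i-th entry of F̄)
  updF : ∀ {f} → (F̄ : FTuple f) (i : Fin (arF f)) → FPart (εF f i) → FTuple f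
  updF F̄ i b k with k ≟ i
  ... | yes refl = b
  ... | no  _    = F̄ k

  updG : ∀ {g} → (Ī : GTuple g) (i : Fin (arG g)) → GPart (εG g i) → GTuple g
  updG Ī i b k with k ≟ i
  ... | yes refl = b
  ... | no  _    = Ī k

  R⋆f : ∀ f → Ideal → FTuple f → Set L
  R⋆f f I F̄ = ∃ λ a → a ∈F̄ F̄ × Ideal.mem I (fOp f a)

  R⋆g : ∀ g → Filter → GTuple g → Set L
  R⋆g g F Ī = ∃ λ a → a ∈Ī Ī × Filter.mem F (gOp g a)

  R⋆f⁽⁰⁾ : ∀ f → FTuple f → Pred Ideal L
  R⋆f⁽⁰⁾ f F̄ I = R⋆f f I F̄

  R⋆g⁽⁰⁾ : ∀ g → GTuple g → Pred Filter L
  R⋆g⁽⁰⁾ g Ī F = R⋆g g F Ī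

  R⋆f⁽_⁾ : ∀ {f} (i : Fin (arF f)) → Ideal → FTuple f → Pred (FPart (εF f i)) L
  R⋆f⁽_⁾ {f} i I₀ F̄ b = R⋆f f I₀ (updF F̄ i b)

  R⋆g⁽_⁾ : ∀ {g} (i : Fin (arG g)) → Filter → GTuple g → Pred (GPart (εG g i)) L
  R⋆g⁽_⁾ {g} i F₀ Ī b = R⋆g g F₀ (updG Ī i b)

  fImg : ∀ f → FTuple f → Pred Carrier L
  fImg f F̄ x = ∃ λ a → a ∈F̄ F̄ × x ≡ fOp f a

  gImg : ∀ g → GTuple g → Pred Carrier L
  gImg g Ī x = ∃ λ a → a ∈Ī Ī × x ≡ gOp g a

  f⁽_⁾ : ∀ {f} (i : Fin (arF f)) → Ideal → FTuple f → Pred Carrier L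
  f⁽_⁾ {f} i I₀ F̄ b = ∃ λ a → a ∈F̄^ i / F̄ × Ideal.mem I₀ (fOp f (a [ i ≔ b ]))

  g⁽_⁾ : ∀ {g} (i : Fin (arG g)) → Filter → GTuple g → Pred Carrier L
  g⁽_⁾ {g} i F₀ Ī b = ∃ λ a → a ∈Ī^ i / Ī × Filter.mem F₀ (gOp g (a [ i ≔ b ]))

  asFilters : ∀ {p ℓ} → p ≡ one → Pred (FPart p) ℓ → Pred Filter ℓ
  asFilters refl X = X

  asIdeals : ∀ {p ℓ} → p ≡ ∂ → Pred (FPart p) ℓ → Pred Ideal ℓ
  asIdeals refl X = X

  asIdealsG : ∀ {p ℓ} → p ≡ one → Pred (GPart p) ℓ → Pred Ideal ℓ
  asIdealsG refl X = X

  asFiltersG : ∀ {p ℓ} → p ≡ ∂ → Pred (GPart p) ℓ → Pred Filter ℓ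
  asFiltersG refl X = X

module Submission where

open import Defs
open import Level using (Level; Lift; lift; lower)
open import Data.Empty using (⊥-elim)
open import Data.Fin using (Fin; _≟_)
open import Data.Product using (_×_; _,_)
open import Relation.Unary using (Pred; _⊆_; _≐_; _≬_)
open import Relation.Nullary using (yes; no)
open import Relation.Binary.PropositionalEquality using (_≡_; refl)
open import Relation.Binary.Lattice.Bundles using (BoundedLattice)

-- Each relation set (R⋆)⁽ⁱ⁾[…] consists exactly of the filters (ideals) meeting the
-- corresponding set S ⊆ 𝔸: a tuple ā witnessing the relation contributes f(ā) (resp. its
-- i-th entry) to S, and conversely each element of S comes with a witnessing tuple.
-- For a family X of ideals meeting S, a filter G lies in X↓ iff S ⊆ G: test G against the
-- principal ideal ↓s of each s ∈ S, and conversely G and I ∈ X share the element of S in I.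
-- Dually for ↑.

update-self : ∀ {a} {A : Set a} {n} (v : Fin n → A) i k → (v [ i ≔ v i ]) k ≡ v k
update-self v i k with k ≟ i
... | yes refl = refl
... | no  _    = refl

module FrameProperties {Sig : LESignature} {c ℓ₁ ℓ₂ : Level} (𝔸 : LEAlgebra Sig c ℓ₁ ℓ₂) where
  open LESignature Sig
  open FilterIdealFrame 𝔸
  open LEAlgebra 𝔸
  open BoundedLattice lattice renaming (refl to ≤-refl)

  principalFilter : Carrier → Filter
  principalFilter b = record
    { mem   = λ x → Lift L (b ≤ x)
    ; mem-⊤ = lift (maximum b)
    ; mem-↑ = λ x≤y b≤x → lift (trans (lower b≤x) x≤y)
    ; mem-∧ = λ b≤x b≤y → lift (∧-greatest (lower b≤x) (lower b≤y))
    }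

  principalIdeal : Carrier → Ideal
  principalIdeal b = record
    { mem   = λ x → Lift L (x ≤ b)
    ; mem-⊥ = lift (minimum b)
    ; mem-↓ = λ y≤x x≤b → lift (trans y≤x (lower x≤b))
    ; mem-∨ = λ x≤b y≤b → lift (∨-least (lower x≤b) (lower y≤b))
    }

  module _ {ℓ ℓ′} {X : Pred Ideal ℓ} {S : Pred Carrier ℓ′} where

    ↓-of-meeting : X ≐ (λ I → S ≬ Ideal.mem I) → (X ↓) ≐ (λ G → S ⊆ Filter.mem G)
    ↓-of-meeting (X⊆ , ⊆X) = (λ {G} → to {G}) , (λ {G} → from {G})
      where
      to : ∀ {G} → (X ↓) G → S ⊆ Filter.mem G
      to {G} G∈X↓ {s} s∈S with G∈X↓ (principalIdeal s) (⊆X (s , s∈S , lift ≤-refl))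
      ... | y , y∈G , lift y≤s = Filter.mem-↑ G y≤s y∈G

      from : ∀ {G} → S ⊆ Filter.mem G → (X ↓) G
      from S⊆G I I∈X with X⊆ I∈X
      ... | s , s∈S , s∈I = s , S⊆G s∈S , s∈I

  module _ {ℓ ℓ′} {X : Pred Filter ℓ} {S : Pred Carrier ℓ′} where

    ↑-of-meeting : X ≐ (λ F → S ≬ Filter.mem F) → (X ↑) ≐ (λ J → S ⊆ Ideal.mem J)
    ↑-of-meeting (X⊆ , ⊆X) = (λ {J} → to {J}) , (λ {J} → from {J})
      where
      to : ∀ {J} → (X ↑) J → S ⊆ Ideal.mem J
      to {J} J∈X↑ {s} s∈S with J∈X↑ (principalFilter s) (⊆X (s , s∈S , lift ≤-refl))
      ... | y , lift s≤y , y∈J = Ideal.mem-↓ J s≤y y∈J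

      from : ∀ {J} → S ⊆ Ideal.mem J → (X ↑) J
      from S⊆J F F∈X with X⊆ F∈X
      ... | s , s∈S , s∈F = s , s∈F , S⊆J s∈S

  -- The polarity is a variable here, so that the equation e can be matched against refl.
  module _ {p : Polarity} {ℓ ℓ′ : Level} {S : Pred Carrier ℓ′} where

    asFilters-meeting : (e : p ≡ one) {X : Pred (FPart p) ℓ} →
      X ≐ (λ x → S ≬ memF p x) → asFilters e X ≐ (λ F → S ≬ Filter.mem F)
    asFilters-meeting refl X≐ = X≐

    asIdeals-meeting : (e : p ≡ ∂) {X : Pred (FPart p) ℓ} →
      X ≐ (λ x → S ≬ memF p x) → asIdeals e X ≐ (λ I → S ≬ Ideal.mem I)
    asIdeals-meeting refl X≐ = X≐

    asIdealsG-meeting : (e : p ≡ one) {X : Pred (GPart p) ℓ} →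
      X ≐ (λ x → S ≬ memG p x) → asIdealsG e X ≐ (λ I → S ≬ Ideal.mem I)
    asIdealsG-meeting refl X≐ = X≐

    asFiltersG-meeting : (e : p ≡ ∂) {X : Pred (GPart p) ℓ} →
      X ≐ (λ x → S ≬ memG p x) → asFiltersG e X ≐ (λ F → S ≬ Filter.mem F)
    asFiltersG-meeting refl X≐ = X≐

  module _ {f} {F̄ : FTuple f} {i : Fin (arF f)} {x : FPart (εF f i)} where

    ∈-updF⁺ : ∀ {a b} → memF (εF f i) x b → a ∈F̄^ i / F̄ → (a [ i ≔ b ]) ∈F̄ updF F̄ i x
    ∈-updF⁺ b∈x a∈F̄ⁱ k with k ≟ i
    ... | yes refl = b∈x
    ... | no  k≢i  = a∈F̄ⁱ k k≢i

    ∈-updF⁻ : ∀ {a} → a ∈F̄ updF F̄ i x → memF (εF f i) x (a i) × a ∈F̄^ i / F̄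
    ∈-updF⁻ {a} a∈ = entry , rest
      where
      entry : memF (εF f i) x (a i)
      entry with i ≟ i | a∈ i
      ... | yes refl | aᵢ∈x = aᵢ∈x
      ... | no  i≢i  | _    = ⊥-elim (i≢i refl)

      rest : a ∈F̄^ i / F̄
      rest k k≢i with k ≟ i | a∈ k
      ... | yes k≡i | _    = ⊥-elim (k≢i k≡i)
      ... | no  _   | aₖ∈ = aₖ∈

  module _ {g} {Ī : GTuple g} {i : Fin (arG g)} {x : GPart (εG g i)} where

    ∈-updG⁺ : ∀ {a b} → memG (εG g i) x b → a ∈Ī^ i / Ī → (a [ i ≔ b ]) ∈Ī updG Ī i x
    ∈-updG⁺ b∈x a∈Īⁱ k with k ≟ i
    ... | yes refl = b∈x
    ... | no  k≢i  = a∈Īⁱ k k≢i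

    ∈-updG⁻ : ∀ {a} → a ∈Ī updG Ī i x → memG (εG g i) x (a i) × a ∈Ī^ i / Ī
    ∈-updG⁻ {a} a∈ = entry , rest
      where
      entry : memG (εG g i) x (a i)
      entry with i ≟ i | a∈ i
      ... | yes refl | aᵢ∈x = aᵢ∈x
      ... | no  i≢i  | _    = ⊥-elim (i≢i refl)

      rest : a ∈Ī^ i / Ī
      rest k k≢i with k ≟ i | a∈ k
      ... | yes k≡i | _    = ⊥-elim (k≢i k≡i)
      ... | no  _   | aₖ∈ = aₖ∈

  fOp-update-self : ∀ f a i → fOp f (a [ i ≔ a i ]) ≈ fOp f a
  fOp-update-self f a i = fOp-cong f (λ k → Eq.reflexive (update-self a i k))

  gOp-update-self : ∀ g a i → gOp g (a [ i ≔ a i ]) ≈ gOp g a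
  gOp-update-self g a i = gOp-cong g (λ k → Eq.reflexive (update-self a i k))

  R⋆f⁽⁰⁾-meeting : ∀ f (F̄ : FTuple f) → R⋆f⁽⁰⁾ f F̄ ≐ (λ I → fImg f F̄ ≬ Ideal.mem I)
  R⋆f⁽⁰⁾-meeting f F̄ =
      (λ { (a , a∈F̄ , fa∈I) → fOp f a , (a , a∈F̄ , refl) , fa∈I })
    , (λ { (_ , (a , a∈F̄ , refl) , fa∈I) → a , a∈F̄ , fa∈I })

  R⋆g⁽⁰⁾-meeting : ∀ g (Ī : GTuple g) → R⋆g⁽⁰⁾ g Ī ≐ (λ F → gImg g Ī ≬ Filter.mem F)
  R⋆g⁽⁰⁾-meeting g Ī =
      (λ { (a , a∈Ī , ga∈F) → gOp g a , (a , a∈Ī , refl) , ga∈F })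
    , (λ { (_ , (a , a∈Ī , refl) , ga∈F) → a , a∈Ī , ga∈F })

  R⋆f⁽ⁱ⁾-meeting : ∀ {f} (i : Fin (arF f)) I₀ (F̄ : FTuple f) →
    R⋆f⁽ i ⁾ I₀ F̄ ≐ (λ x → f⁽ i ⁾ I₀ F̄ ≬ memF (εF f i) x)
  R⋆f⁽ⁱ⁾-meeting {f} i I₀ F̄ = to , from
    where
    to : ∀ {x} → R⋆f⁽ i ⁾ I₀ F̄ x → f⁽ i ⁾ I₀ F̄ ≬ memF (εF f i) x
    to (a , a∈ , fa∈I₀) with ∈-updF⁻ a∈
    ... | aᵢ∈x , a∈F̄ⁱ =
      a i , (a , a∈F̄ⁱ , Ideal.mem-↓ I₀ (reflexive (fOp-update-self f a i)) fa∈I₀) , aᵢ∈x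

    from : ∀ {x} → f⁽ i ⁾ I₀ F̄ ≬ memF (εF f i) x → R⋆f⁽ i ⁾ I₀ F̄ x
    from (b , (a , a∈F̄ⁱ , fab∈I₀) , b∈x) = a [ i ≔ b ] , ∈-updF⁺ b∈x a∈F̄ⁱ , fab∈I₀

  R⋆g⁽ⁱ⁾-meeting : ∀ {g} (i : Fin (arG g)) F₀ (Ī : GTuple g) →
    R⋆g⁽ i ⁾ F₀ Ī ≐ (λ x → g⁽ i ⁾ F₀ Ī ≬ memG (εG g i) x)
  R⋆g⁽ⁱ⁾-meeting {g} i F₀ Ī = to , from
    where
    to : ∀ {x} → R⋆g⁽ i ⁾ F₀ Ī x → g⁽ i ⁾ F₀ Ī ≬ memG (εG g i) x
    to (a , a∈ , ga∈F₀) with ∈-updG⁻ a∈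
    ... | aᵢ∈x , a∈Īⁱ =
      a i , (a , a∈Īⁱ , Filter.mem-↑ F₀ (reflexive (Eq.sym (gOp-update-self g a i))) ga∈F₀) , aᵢ∈x

    from : ∀ {x} → g⁽ i ⁾ F₀ Ī ≬ memG (εG g i) x → R⋆g⁽ i ⁾ F₀ Ī x
    from (b , (a , a∈Īⁱ , gab∈F₀) , b∈x) = a [ i ≔ b ] , ∈-updG⁺ b∈x a∈Īⁱ , gab∈F₀

mainTheorem11 : {Sig : LESignature} {c ℓ₁ ℓ₂ : Level} (𝔸 : LEAlgebra Sig c ℓ₁ ℓ₂) →
    let open LESignature Sig
        open FilterIdealFrame 𝔸
    in
    -- (1)
    (∀ f (F̄ : FTuple f) →
       (R⋆f⁽⁰⁾ f F̄ ↓) ≐ (λ G → fImg f F̄ ⊆ Filter.mem G))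
    × -- (2)
    (∀ g (Ī : GTuple g) →
       (R⋆g⁽⁰⁾ g Ī ↑) ≐ (λ J → gImg g Ī ⊆ Ideal.mem J))
    × -- (3)
    (∀ f (F̄ : FTuple f) (I₀ : Ideal) (i : Fin (arF f)) (e : εF f i ≡ one) →
       (asFilters e (R⋆f⁽ i ⁾ I₀ F̄) ↑) ≐ (λ J → f⁽ i ⁾ I₀ F̄ ⊆ Ideal.mem J))
    × -- (4)
    (∀ f (F̄ : FTuple f) (I₀ : Ideal) (i : Fin (arF f)) (e : εF f i ≡ ∂) →
       (asIdeals e (R⋆f⁽ i ⁾ I₀ F̄) ↓) ≐ (λ G → f⁽ i ⁾ I₀ F̄ ⊆ Filter.mem G))
    × -- (5)
    (∀ g (Ī : GTuple g) (F₀ : Filter) (i : Fin (arG g)) (e : εG g i ≡ one) →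
       (asIdealsG e (R⋆g⁽ i ⁾ F₀ Ī) ↓) ≐ (λ G → g⁽ i ⁾ F₀ Ī ⊆ Filter.mem G))
    × -- (6)
    (∀ g (Ī : GTuple g) (F₀ : Filter) (i : Fin (arG g)) (e : εG g i ≡ ∂) →
       (asFiltersG e (R⋆g⁽ i ⁾ F₀ Ī) ↑) ≐ (λ J → g⁽ i ⁾ F₀ Ī ⊆ Ideal.mem J))
mainTheorem11 𝔸 =
    (λ f F̄ → ↓-of-meeting (R⋆f⁽⁰⁾-meeting f F̄))
  , (λ g Ī → ↑-of-meeting (R⋆g⁽⁰⁾-meeting g Ī))
  , (λ f F̄ I₀ i e → ↑-of-meeting (asFilters-meeting e (R⋆f⁽ⁱ⁾-meeting i I₀ F̄)))
  , (λ f F̄ I₀ i e → ↓-of-meeting (asIdeals-meeting e (R⋆f⁽ⁱ⁾-meeting i I₀ F̄)))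
  , (λ g Ī F₀ i e → ↓-of-meeting (asIdealsG-meeting e (R⋆g⁽ⁱ⁾-meeting i F₀ Ī)))
  , (λ g Ī F₀ i e → ↑-of-meeting (asFiltersG-meeting e (R⋆g⁽ⁱ⁾-meeting i F₀ Ī)))
  where open FrameProperties 𝔸
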